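{- Let $A$ be an ordered alphabet and $A^{\ast}$ the free monoid ordered by the Higman ordering. Then $Ant(A^{\ast})$ and $Ant_{<\omega}(A^{\ast})$ are submonoids of $\mathcal P(A^{\ast})$. The map $X\mapsto\uparrow X$ from $\mathcal P(A^{\ast})$ to $F(A^{\ast})$ restricts to a one-to-one monoid morphism from $Ant(A^{\ast})$ into $F(A^{\ast})$. The map associating to each final segment $X$ of $A^{\ast}$ the set $Min(X)$ of its minimal elements is a monoid morphism from $F(A^{\ast})$ onto $Ant(A^{\ast})$.
   Context: Higman ordering: $a_0\cdots a_{n-1}\le b_0\cdots b_{m-1}$ iff there is a strictly increasing $h$ with $a_i\le b_{h(i)}$ for all $i$. $\mathcal P(A^{\ast})$ is the monoid of all subsets of $A^{\ast}$ under concatenation $XY=\{\alpha\beta:\alpha\in X,\beta\in Y\}$ with neutral element $\{\Box\}$. $F(A^{\ast})$ is the monoid of final segments (upward closed subsets) under concatenation, with neutral element $A^{\ast}$. $Ant(A^{\ast})$ is the set of antichains (subsets of pairwise incomparable words) and $Ant_{<\omega}(A^{\ast})$ the set of finite antichains. $\uparrow X:=\{\beta:\alpha\le\beta\text{ for some }\alpha\in X\}$. -}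

module Defs where

open import Level using (0ℓ)
open import Data.List using (List; []; _∷_; _++_; length; lookup)
open import Data.List.Membership.Propositional using (_∈_)
open import Data.Fin using (Fin) renaming (_<_ to _<ᶠ_)
open import Data.Product using (Σ; ∃; ∃₂; _×_; _,_)
open import Relation.Binary.PropositionalEquality using (_≡_)
open import Relation.Unary using (Pred)
open import Function.Bundles using (_⇔_)

module Words {A : Set} (_≤_ : A → A → Set) where

  Word : Set
  Word = List A

  _⊑_ : Word → Word → Set
  as ⊑ bs = Σ (Fin (length as) → Fin (length bs)) λ h →
              (∀ i j → i <ᶠ j → h i <ᶠ h j) ×
              (∀ i → lookup as i ≤ lookup bs (h i))

  Subset : Set₁
  Subset = Pred Word 0ℓ

  _·_ : Subset → Subset → Subset
  (X · Y) w = ∃₂ λ α β → X α × Y β × w ≡ α ++ β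

  ｛□｝ : Subset
  ｛□｝ w = w ≡ []

  Full : Subset
  Full w = Word

  IsFinal : Subset → Set
  IsFinal X = ∀ α β → X α → α ⊑ β → X β

  IsAntichain : Subset → Set
  IsAntichain X = ∀ α β → X α → X β → α ⊑ β → α ≡ β

  IsFinite : Subset → Set
  IsFinite X = Σ (List Word) λ L → ∀ w → X w ⇔ (w ∈ L)

  IsFiniteAntichain : Subset → Set
  IsFiniteAntichain X = IsAntichain X × IsFinite X

  ↑ : Subset → Subset
  ↑ X β = ∃ λ α → X α × α ⊑ β

  Min : Subset → Subset
  Min X β = X β × (∀ α → X α → α ⊑ β → α ≡ β)

module Submission where

-- The Higman order ⊑ on words, defined by strictly increasing
-- position maps, coincides with the inductive "sublist up to ≤" relation of
-- the standard library (Data.List.Relation.Binary.Sublist.Heterogeneous).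
-- Transporting along this equivalence, ⊑ is a partial order which is
-- monotone for concatenation and admits splitting: if αβ ⊑ w then w = w₁w₂
-- with α ⊑ w₁ and β ⊑ w₂.  Combined with Levi's lemma (equidivisibility of
-- the free monoid) this gives the key rigidity fact: a concatenation of
-- words which are minimal below α and below β is minimal below αβ.
-- The statement is then pure order theory on subsets of A*:
--   * Min (X · Y) = Min X · Min Y for ALL subsets X, Y;
--   * X is an antichain iff X ⊆ Min X, so antichains are closed under products;
--   * ↑ (X · Y) = ↑ X · ↑ Y for all X, Y (splitting and monotonicity);
--   * Min (↑ X) = X for an antichain X, which gives both injectivity of ↑ on
--     antichains and surjectivity of Min onto antichains;
--   * finiteness is preserved since X · Y is enumerated by the product list.

open import Defs
open import Data.Product using (Σ; _×_; _,_; ∃; ∃₂; proj₁; proj₂)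
open import Data.Sum using (_⊎_; inj₁; inj₂)
open import Function using (_∘_)
open import Function.Bundles using (mk⇔; Equivalence)
open import Relation.Binary.Structures using (IsPartialOrder)
open import Relation.Binary.PropositionalEquality
  using (_≡_; refl; sym; trans; cong; cong₂; subst; subst₂)
open import Relation.Unary using (_≐_; _⊆_)
open import Relation.Unary.Properties using (≐-sym; ≐-trans)
open import Data.Nat using (suc; z≤n; s≤s) renaming (_<_ to _<ℕ_)
open import Data.Nat.Properties using (≤-pred) renaming (≤-trans to ℕ-≤-trans)
open import Data.Fin using (Fin; toℕ; lift) renaming (zero to fz; suc to fs; _<_ to _<ᶠ_)
open import Data.List using (List; []; _∷_; _++_; length; lookup; cartesianProductWith)
open import Data.List.Properties using (++-cancelˡ; ++-cancelʳ; ∷-injectiveˡ; ∷-injectiveʳ)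
open import Data.List.Membership.Propositional using (_∈_)
open import Data.List.Membership.Propositional.Properties
  using (∈-cartesianProductWith⁺; ∈-cartesianProductWith⁻)
open import Data.List.Relation.Unary.Any using (here; there)
open import Data.List.Relation.Binary.Pointwise using (Pointwise-≡⇒≡)
open import Data.List.Relation.Binary.Sublist.Heterogeneous
  using (Sublist; []; _∷ʳ_; _∷_; minimum)
import Data.List.Relation.Binary.Sublist.Heterogeneous.Properties as Sublist

levi : ∀ {A : Set} (w₁ w₂ u v : List A) → w₁ ++ w₂ ≡ u ++ v →
       (∃ λ m → u ≡ w₁ ++ m × w₂ ≡ m ++ v) ⊎ (∃ λ m → w₁ ≡ u ++ m × v ≡ m ++ w₂)
levi []       w₂ u       v eq = inj₁ (u , refl , eq)
levi (x ∷ w₁) w₂ []      v eq = inj₂ (x ∷ w₁ , refl , sym eq)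
levi (x ∷ w₁) w₂ (y ∷ u) v eq with levi w₁ w₂ u v (∷-injectiveʳ eq)
... | inj₁ (m , u≡w₁m , w₂≡mv) = inj₁ (m , cong₂ _∷_ (sym (∷-injectiveˡ eq)) u≡w₁m , w₂≡mv)
... | inj₂ (m , w₁≡um , v≡mw₂) = inj₂ (m , cong₂ _∷_ (∷-injectiveˡ eq) w₁≡um , v≡mw₂)

positive⇒fs : ∀ {m} (k : Fin (suc m)) → 0 <ℕ toℕ k → ∃ λ k′ → k ≡ fs k′
positive⇒fs (fs k′) _ = k′ , refl

module HigmanMonoids {A : Set} (_≤_ : A → A → Set) (po : IsPartialOrder _≡_ _≤_) where
  open Words _≤_
  open IsPartialOrder po using (antisym) renaming (refl to ≤-refl; trans to ≤-trans)

  infix 4 _≼_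
  _≼_ : Word → Word → Set
  _≼_ = Sublist _≤_

  ⊑-[] : ∀ bs → [] ⊑ bs
  ⊑-[] _ = (λ ()) , (λ ()) , (λ ())

  ⊑-skip : ∀ as b bs → as ⊑ bs → as ⊑ (b ∷ bs)
  ⊑-skip _ _ _ (h , mono , pw) = fs ∘ h , (λ i j i<j → s≤s (mono i j i<j)) , pw

  ⊑-take : ∀ a as b bs → a ≤ b → as ⊑ bs → (a ∷ as) ⊑ (b ∷ bs)
  ⊑-take a as b bs a≤b (h , mono , pw) = lift 1 h , mono′ , pw′
    where
    mono′ : ∀ i j → i <ᶠ j → lift 1 h i <ᶠ lift 1 h j
    mono′ fz     (fs j) _         = s≤s z≤n
    mono′ (fs i) (fs j) (s≤s i<j) = s≤s (mono i j i<j)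
    pw′ : ∀ i → lookup (a ∷ as) i ≤ lookup (b ∷ bs) (lift 1 h i)
    pw′ fz     = a≤b
    pw′ (fs i) = pw i

  ≼⇒⊑ : ∀ {as bs} → as ≼ bs → as ⊑ bs
  ≼⇒⊑ []                            = ⊑-[] []
  ≼⇒⊑ {as}     {b ∷ bs} (_ ∷ʳ p)  = ⊑-skip as b bs (≼⇒⊑ p)
  ≼⇒⊑ {a ∷ as} {b ∷ bs} (a≤b ∷ p) = ⊑-take a as b bs a≤b (≼⇒⊑ p)

  ⊑-unshift : ∀ as b bs (p : as ⊑ (b ∷ bs)) → (∀ i → 0 <ℕ toℕ (proj₁ p i)) → as ⊑ bs
  ⊑-unshift as b bs (h , mono , pw) pos = h′ , mono′ , pw′
    where
    h′ : Fin (length as) → Fin (length bs)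
    h′ i = proj₁ (positive⇒fs (h i) (pos i))
    h≡fs∘h′ : ∀ i → h i ≡ fs (h′ i)
    h≡fs∘h′ i = proj₂ (positive⇒fs (h i) (pos i))
    mono′ : ∀ i j → i <ᶠ j → h′ i <ᶠ h′ j
    mono′ i j i<j = ≤-pred (subst₂ _<ᶠ_ (h≡fs∘h′ i) (h≡fs∘h′ j) (mono i j i<j))
    pw′ : ∀ i → lookup as i ≤ lookup bs (h′ i)
    pw′ i = subst (λ k → lookup as i ≤ lookup (b ∷ bs) k) (h≡fs∘h′ i) (pw i)

  ⊑-tail-positive : ∀ a as bs (p : (a ∷ as) ⊑ bs) → ∀ i → 0 <ℕ toℕ (proj₁ p (fs i))
  ⊑-tail-positive _ _ _ (h , mono , _) i = ℕ-≤-trans (s≤s z≤n) (mono fz (fs i) (s≤s z≤n))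

  ⊑-behead : ∀ a as b bs → (a ∷ as) ⊑ (b ∷ bs) → as ⊑ bs
  ⊑-behead a as b bs p@(h , mono , pw) =
    ⊑-unshift as b bs (h ∘ fs , (λ i j i<j → mono (fs i) (fs j) (s≤s i<j)) , pw ∘ fs)
              (⊑-tail-positive a as (b ∷ bs) p)

  ⊑⇒≼ : ∀ as bs → as ⊑ bs → as ≼ bs
  ⊑⇒≼ []       bs       _              = minimum bs
  ⊑⇒≼ (_ ∷ _)  []       (h , _)        with h fz
  ... | ()
  ⊑⇒≼ (a ∷ as) (b ∷ bs) p@(h , _ , pw) with h fz in h0
  ... | fz   = subst (λ k → a ≤ lookup (b ∷ bs) k) h0 (pw fz) ∷ ⊑⇒≼ as bs (⊑-behead a as b bs p)
  ... | fs _ = b ∷ʳ ⊑⇒≼ (a ∷ as) bs (⊑-unshift (a ∷ as) b bs p positive)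
    where
    positive : ∀ i → 0 <ℕ toℕ (h i)
    positive fz rewrite h0 = s≤s z≤n
    positive (fs i) = ⊑-tail-positive a as (b ∷ bs) p i

  ≼-split : ∀ α {β w} → α ++ β ≼ w → ∃₂ λ w₁ w₂ → w ≡ w₁ ++ w₂ × α ≼ w₁ × β ≼ w₂
  ≼-split []      {w = w} p = [] , w , refl , [] , p
  ≼-split (a ∷ α) (c ∷ʳ p) with ≼-split (a ∷ α) p
  ... | w₁ , w₂ , eq , p₁ , p₂ = c ∷ w₁ , w₂ , cong (c ∷_) eq , c ∷ʳ p₁ , p₂
  ≼-split (a ∷ α) (_∷_ {y = c} a≤c p) with ≼-split α p
  ... | w₁ , w₂ , eq , p₁ , p₂ = c ∷ w₁ , w₂ , cong (c ∷_) eq , a≤c ∷ p₁ , p₂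

  -- The Higman order is a partial order, compatible with concatenation.
  -- (⊑ unfolds to a Σ-type from which Agda cannot recover the words, so the
  -- words are explicit arguments.)
  ≼-refl : ∀ w → w ≼ w
  ≼-refl w = Sublist.refl ≤-refl

  ⊑-refl : ∀ w → w ⊑ w
  ⊑-refl w = ≼⇒⊑ (≼-refl w)

  ⊑-trans : ∀ α β γ → α ⊑ β → β ⊑ γ → α ⊑ γ
  ⊑-trans α β γ p q = ≼⇒⊑ (Sublist.trans ≤-trans (⊑⇒≼ α β p) (⊑⇒≼ β γ q))

  ⊑-antisym : ∀ α β → α ⊑ β → β ⊑ α → α ≡ β
  ⊑-antisym α β p q = Pointwise-≡⇒≡ (Sublist.antisym antisym (⊑⇒≼ α β p) (⊑⇒≼ β α q))

  ⊑-++ : ∀ α β γ δ → α ⊑ β → γ ⊑ δ → (α ++ γ) ⊑ (β ++ δ)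
  ⊑-++ α β γ δ p q = ≼⇒⊑ (Sublist.++⁺ (⊑⇒≼ α β p) (⊑⇒≼ γ δ q))

  ⊑-prefix : ∀ α m → α ⊑ (α ++ m)
  ⊑-prefix α m = ≼⇒⊑ (Sublist.++ʳ m (≼-refl α))

  ⊑-suffix : ∀ m α → α ⊑ (m ++ α)
  ⊑-suffix m α = ≼⇒⊑ (Sublist.++ˡ m (≼-refl α))

  ⊑-split : ∀ α β w → (α ++ β) ⊑ w → ∃₂ λ w₁ w₂ → w ≡ w₁ ++ w₂ × α ⊑ w₁ × β ⊑ w₂
  ⊑-split α β w p with ≼-split α (⊑⇒≼ (α ++ β) w p)
  ... | w₁ , w₂ , eq , p₁ , p₂ = w₁ , w₂ , eq , ≼⇒⊑ p₁ , ≼⇒⊑ p₂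

  -- The split of αβ given by ⊑-split is compared with the
  -- split (α, β) by Levi's lemma; antisymmetry shows the two cuts coincide.
  ++-rigid : ∀ α′ β′ α β → (α′ ++ β′) ⊑ (α ++ β) →
             (α′ ⊑ α → α′ ≡ α) → (β′ ⊑ β → β′ ≡ β) → α′ ++ β′ ≡ α ++ β
  ++-rigid α′ β′ α β le minα minβ with ⊑-split α′ β′ (α ++ β) le
  ... | w₁ , w₂ , αβ≡w₁w₂ , α′⊑w₁ , β′⊑w₂ with levi w₁ w₂ α β (sym αβ≡w₁w₂)
  ... | inj₁ (m , α≡w₁m , _) = cong₂ _++_ α′≡α β′≡β
    where
    w₁⊑α : w₁ ⊑ α
    w₁⊑α = subst (w₁ ⊑_) (sym α≡w₁m) (⊑-prefix w₁ m)
    α′≡α : α′ ≡ α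
    α′≡α = minα (⊑-trans α′ w₁ α α′⊑w₁ w₁⊑α)
    w₁≡α : w₁ ≡ α
    w₁≡α = ⊑-antisym w₁ α w₁⊑α (subst (_⊑ w₁) α′≡α α′⊑w₁)
    w₂≡β : w₂ ≡ β
    w₂≡β = ++-cancelˡ α w₂ β (trans (cong (_++ w₂) (sym w₁≡α)) (sym αβ≡w₁w₂))
    β′≡β : β′ ≡ β
    β′≡β = minβ (subst (β′ ⊑_) w₂≡β β′⊑w₂)
  ... | inj₂ (m , _ , β≡mw₂) = cong₂ _++_ α′≡α β′≡β
    where
    w₂⊑β : w₂ ⊑ β
    w₂⊑β = subst (w₂ ⊑_) (sym β≡mw₂) (⊑-suffix m w₂)
    β′≡β : β′ ≡ β
    β′≡β = minβ (⊑-trans β′ w₂ β β′⊑w₂ w₂⊑β)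
    w₂≡β : w₂ ≡ β
    w₂≡β = ⊑-antisym w₂ β w₂⊑β (subst (_⊑ w₂) β′≡β β′⊑w₂)
    w₁≡α : w₁ ≡ α
    w₁≡α = ++-cancelʳ β w₁ α (trans (cong (w₁ ++_) (sym w₂≡β)) (sym αβ≡w₁w₂))
    α′≡α : α′ ≡ α
    α′≡α = minα (subst (α′ ⊑_) w₁≡α α′⊑w₁)

  ·-mono : ∀ {X X′ Y Y′} → X ⊆ X′ → Y ⊆ Y′ → X · Y ⊆ X′ · Y′
  ·-mono f g (α , β , xα , yβ , eq) = α , β , f xα , g yβ , eq

  Min-cong : ∀ {X Y} → X ≐ Y → Min X ≐ Min Y
  Min-cong (f , g) = (λ (xβ , m) → f xβ , λ α yα → m α (g yα))
                   , (λ (yβ , m) → g yβ , λ α xα → m α (f xα))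

  Min-antichain : ∀ X → IsAntichain (Min X)
  Min-antichain X α β (xα , _) (_ , minβ) α⊑β = minβ α xα α⊑β

  antichain⇒⊆Min : ∀ {X} → IsAntichain X → X ⊆ Min X
  antichain⇒⊆Min aX {β} xβ = xβ , λ α xα α⊑β → aX α β xα xβ α⊑β

  ⊆Min⇒antichain : ∀ {X} → X ⊆ Min X → IsAntichain X
  ⊆Min⇒antichain sub α β xα xβ α⊑β = proj₂ (sub xβ) α xα α⊑β

  -- Min is a morphism for concatenation, for arbitrary subsets.  (⊆) uses
  -- monotonicity and cancellation, (⊇) is the rigidity lemma.
  Min-· : ∀ X Y → Min (X · Y) ≐ (Min X · Min Y)
  Min-· X Y = to , from
    where
    to : Min (X · Y) ⊆ (Min X · Min Y)
    to ((α , β , xα , yβ , w≡αβ) , minw) = α , β , (xα , minα) , (yβ , minβ) , w≡αβ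
      where
      minα : ∀ α′ → X α′ → α′ ⊑ α → α′ ≡ α
      minα α′ xα′ α′⊑α = ++-cancelʳ β α′ α (trans (minw (α′ ++ β) (α′ , β , xα′ , yβ , refl)
        (subst ((α′ ++ β) ⊑_) (sym w≡αβ) (⊑-++ α′ α β β α′⊑α (⊑-refl β)))) w≡αβ)
      minβ : ∀ β′ → Y β′ → β′ ⊑ β → β′ ≡ β
      minβ β′ yβ′ β′⊑β = ++-cancelˡ α β′ β (trans (minw (α ++ β′) (α , β′ , xα , yβ′ , refl)
        (subst ((α ++ β′) ⊑_) (sym w≡αβ) (⊑-++ α α β′ β (⊑-refl α) β′⊑β))) w≡αβ)
    from : (Min X · Min Y) ⊆ Min (X · Y)
    from {w} (α , β , (xα , minα) , (yβ , minβ) , w≡αβ) = (α , β , xα , yβ , w≡αβ) , minw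
      where
      minw : ∀ γ → (X · Y) γ → γ ⊑ w → γ ≡ w
      minw γ (α′ , β′ , xα′ , yβ′ , γ≡α′β′) γ⊑w =
        trans γ≡α′β′ (trans (++-rigid α′ β′ α β (subst₂ _⊑_ γ≡α′β′ w≡αβ γ⊑w)
          (minα α′ xα′) (minβ β′ yβ′)) (sym w≡αβ))

  □-antichain : IsAntichain ｛□｝
  □-antichain _ _ refl refl _ = refl

  ·-antichain : ∀ X Y → IsAntichain X → IsAntichain Y → IsAntichain (X · Y)
  ·-antichain X Y aX aY = ⊆Min⇒antichain
    (proj₂ (Min-· X Y) ∘ ·-mono (antichain⇒⊆Min aX) (antichain⇒⊆Min aY))

  □-finite : IsFinite ｛□｝
  □-finite = [] ∷ [] , λ w → mk⇔ (λ { refl → here refl }) (λ { (here w≡□) → w≡□ ; (there ()) })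

  ·-finite : ∀ X Y → IsFinite X → IsFinite Y → IsFinite (X · Y)
  ·-finite X Y (LX , enumX) (LY , enumY) = cartesianProductWith _++_ LX LY , λ w → mk⇔ to (from w)
    where
    to : ∀ {w} → (X · Y) w → w ∈ cartesianProductWith _++_ LX LY
    to (α , β , xα , yβ , refl) =
      ∈-cartesianProductWith⁺ _++_ (Equivalence.to (enumX α) xα) (Equivalence.to (enumY β) yβ)
    from : ∀ w → w ∈ cartesianProductWith _++_ LX LY → (X · Y) w
    from w w∈ with ∈-cartesianProductWith⁻ _++_ LX LY w∈
    ... | α , β , α∈ , β∈ , w≡αβ =
      α , β , Equivalence.from (enumX α) α∈ , Equivalence.from (enumY β) β∈ , w≡αβ

  ↑-final : ∀ X → IsFinal (↑ X)
  ↑-final X α β (γ , xγ , γ⊑α) α⊑β = γ , xγ , ⊑-trans γ α β γ⊑α α⊑β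

  ↑-□ : ↑ ｛□｝ ≐ Full
  ↑-□ = (λ {w} _ → w) , (λ {w} _ → [] , refl , ⊑-[] w)

  ↑-· : ∀ X Y → ↑ (X · Y) ≐ (↑ X · ↑ Y)
  ↑-· X Y = to , from
    where
    to : ↑ (X · Y) ⊆ (↑ X · ↑ Y)
    to {w} (γ , (α , β , xα , yβ , refl) , αβ⊑w) with ⊑-split α β w αβ⊑w
    ... | w₁ , w₂ , w≡w₁w₂ , α⊑w₁ , β⊑w₂ =
      w₁ , w₂ , (α , xα , α⊑w₁) , (β , yβ , β⊑w₂) , w≡w₁w₂
    from : (↑ X · ↑ Y) ⊆ ↑ (X · Y)
    from (u , v , (α , xα , α⊑u) , (β , yβ , β⊑v) , w≡uv) =
      α ++ β , (α , β , xα , yβ , refl) , subst ((α ++ β) ⊑_) (sym w≡uv) (⊑-++ α u β v α⊑u β⊑v)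

  Min-↑ : ∀ {X} → IsAntichain X → Min (↑ X) ≐ X
  Min-↑ {X} aX = to , from
    where
    to : Min (↑ X) ⊆ X
    to ((α , xα , α⊑β) , minβ) = subst X (minβ α (α , xα , ⊑-refl α) α⊑β) xα
    from : X ⊆ Min (↑ X)
    from {α} xα = (α , xα , ⊑-refl α) , minα
      where
      minα : ∀ γ → ↑ X γ → γ ⊑ α → γ ≡ α
      minα γ (δ , xδ , δ⊑γ) γ⊑α =
        ⊑-antisym γ α γ⊑α (subst (_⊑ γ) (aX δ α xδ xα (⊑-trans δ γ α δ⊑γ γ⊑α)) δ⊑γ)

  Min-onto : ∀ Y → IsAntichain Y → Σ Subset λ X → IsFinal X × (Min X ≐ Y)
  Min-onto Y aY = ↑ Y , ↑-final Y , Min-↑ aY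

  ↑-injective : ∀ X Y → IsAntichain X → IsAntichain Y → ↑ X ≐ ↑ Y → X ≐ Y
  ↑-injective X Y aX aY ↑X≐↑Y =
    ≐-trans (≐-sym (Min-↑ aX)) (≐-trans (Min-cong ↑X≐↑Y) (Min-↑ aY))

  Min-Full : Min Full ≐ ｛□｝
  Min-Full = (λ {w} (_ , minw) → sym (minw [] w (⊑-[] w)))
           , (λ { refl → [] , λ α _ α⊑□ → ⊑-antisym α [] α⊑□ (⊑-[] α) })

lemma8 : {A : Set} (_≤_ : A → A → Set) → IsPartialOrder _≡_ _≤_ →
    let open Words _≤_ in
    (IsAntichain ｛□｝ ×
     (∀ X Y → IsAntichain X → IsAntichain Y → IsAntichain (X · Y))) ×
    (IsFiniteAntichain ｛□｝ ×
     (∀ X Y → IsFiniteAntichain X → IsFiniteAntichain Y → IsFiniteAntichain (X · Y))) ×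
    ((∀ X → IsAntichain X → IsFinal (↑ X)) ×
     (↑ ｛□｝ ≐ Full) ×
     (∀ X Y → IsAntichain X → IsAntichain Y → ↑ (X · Y) ≐ (↑ X · ↑ Y)) ×
     (∀ X Y → IsAntichain X → IsAntichain Y → ↑ X ≐ ↑ Y → X ≐ Y)) ×
    ((∀ X → IsFinal X → IsAntichain (Min X)) ×
     (Min Full ≐ ｛□｝) ×
     (∀ X Y → IsFinal X → IsFinal Y → Min (X · Y) ≐ (Min X · Min Y)) ×
     (∀ Y → IsAntichain Y → Σ Subset λ X → IsFinal X × (Min X ≐ Y)))
lemma8 _≤_ po =
  (□-antichain , ·-antichain) ,
  ((□-antichain , □-finite) ,
   (λ X Y (aX , fX) (aY , fY) → ·-antichain X Y aX aY , ·-finite X Y fX fY)) ,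
  ((λ X _ → ↑-final X) , ↑-□ , (λ X Y _ _ → ↑-· X Y) , ↑-injective) ,
  ((λ X _ → Min-antichain X) , Min-Full , (λ X Y _ _ → Min-· X Y) , Min-onto)
  where open HigmanMonoids _≤_ po
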